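{- Let $p>2$ be a prime, let $X,Y\subset\mathbb{Z}_p$ with $|Y|>1$, let $a\in\mathbb{Z}_p^*$, and suppose $Q[X,Y]\neq\mathbb{Z}_p$. Then $$|2XY-2XY+a*Y^2-a*Y^2|\geq|X||Y|.$$
   Context: $\mathbb{Z}_p$ is the field of residues modulo $p$, $\mathbb{Z}_p^*=\mathbb{Z}_p\setminus\{0\}$. For $X,Y\subset\mathbb{Z}_p$ with $|Y|>1$, $Q[X,Y]=\left\{\frac{x_1-x_2}{y_1-y_2}:\ x_1,x_2\in X,\ y_1,y_2\in Y,\ y_1\neq y_2\right\}$. $XY=\{xy:x\in X,y\in Y\}$, $Y^2=\{y_1y_2:\ y_1,y_2\in Y\}$, $a*S=\{as:\ s\in S\}$, $kS=\{s_1+\dots+s_k:\ s_i\in S\}$, and sums/differences of sets are elementwise: $S+T=\{s+t\}$, $S-T=\{s-t\}$. Thus $2XY-2XY+a*Y^2-a*Y^2=\{s_1-s_2+t_1-t_2:\ s_1,s_2\in 2(XY),\ t_1,t_2\in a*Y^2\}$. -}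

module Defs where

open import Data.Nat using (ℕ; NonZero; _∸_)
import Data.Nat as ℕ
open import Data.Nat.DivMod using (_mod_)
open import Data.Fin using (Fin; toℕ)
open import Data.Fin.Subset using (Subset; _∈_)
open import Data.Product using (∃-syntax; _×_)
open import Relation.Binary.PropositionalEquality using (_≡_; _≢_)

module Zp (p : ℕ) .{{_ : NonZero p}} where

  _+ₚ_ : Fin p → Fin p → Fin p
  a +ₚ b = (toℕ a ℕ.+ toℕ b) mod p

  _*ₚ_ : Fin p → Fin p → Fin p
  a *ₚ b = (toℕ a ℕ.* toℕ b) mod p

  -ₚ_ : Fin p → Fin p
  -ₚ a = (p ∸ toℕ a) mod p

  _-ₚ_ : Fin p → Fin p → Fin p
  a -ₚ b = a +ₚ (-ₚ b)

  infixl 6 _+ₚ_ _-ₚ_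
  infixl 7 _*ₚ_

  -- z ∈ Q[X,Y] : z = (x₁ - x₂)/(y₁ - y₂) with y₁ ≠ y₂, i.e.
  -- z * (y₁ - y₂) = x₁ - x₂ (division by the nonzero y₁ - y₂ in the field ℤ_p).
  InQ : Subset p → Subset p → Fin p → Set
  InQ X Y z = ∃[ x₁ ] ∃[ x₂ ] ∃[ y₁ ] ∃[ y₂ ]
    (x₁ ∈ X × x₂ ∈ X × y₁ ∈ Y × y₂ ∈ Y × y₁ ≢ y₂ ×
     z *ₚ (y₁ -ₚ y₂) ≡ x₁ -ₚ x₂)

  InProd : Subset p → Subset p → Fin p → Set
  InProd X Y u = ∃[ x ] ∃[ y ] (x ∈ X × y ∈ Y × u ≡ x *ₚ y)

  In2XY : Subset p → Subset p → Fin p → Set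
  In2XY X Y s = ∃[ u₁ ] ∃[ u₂ ] (InProd X Y u₁ × InProd X Y u₂ × s ≡ u₁ +ₚ u₂)

  InAY² : Fin p → Subset p → Fin p → Set
  InAY² a Y t = ∃[ w ] (InProd Y Y w × t ≡ a *ₚ w)

  InS : Fin p → Subset p → Subset p → Fin p → Set
  InS a X Y z = ∃[ s₁ ] ∃[ s₂ ] ∃[ t₁ ] ∃[ t₂ ]
    (In2XY X Y s₁ × In2XY X Y s₂ × InAY² a Y t₁ × InAY² a Y t₂ ×
     z ≡ s₁ -ₚ s₂ +ₚ t₁ -ₚ t₂)

{-# OPTIONS --safe #-}
module Submission where

-- Since 0 ∈ Q[X,Y] ≠ ℤ_p and the multiples of a ≠ 0 exhaust ℤ_p, walking along 0, a, 2a, …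
-- yields ξ = (x₁ - x₂)/(y₁ - y₂) ∈ Q[X,Y] with ξ + a ∉ Q[X,Y].  Then
--   (x , y) ↦ (y₁ - y₂)(x + (ξ + a) y) = x y₁ + x₁ y - (x y₂ + x₂ y) + a y₁ y - a y₂ y
-- maps X × Y into 2XY - 2XY + a*Y² - a*Y², injectively: x + (ξ + a) y = x′ + (ξ + a) y′ with
-- y ≠ y′ would put ξ + a = (x′ - x)/(y - y′) into Q[X,Y].

open import Defs
open import Data.Bool using (true; false)
open import Data.Vec using (_∷_; here; there)
open import Data.Fin using (Fin; zero; suc; toℕ)
open import Data.Fin.Properties using (suc-injective; toℕ-injective; toℕ<n; toℕ-fromℕ<; injective⇒≤; *↔×; any?; ¬∀⟶∃¬; _≟_)
open import Data.Fin.Subset using (Subset; _∈_; ∣_∣; Empty)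
open import Data.Fin.Subset.Properties using (_∈?_; nonempty?; Empty-unique; ∣⊥∣≡0)
open import Data.Integer as ℤ using (ℤ)
import Data.Integer.Properties as ℤ
open import Data.Integer.DivMod using (_%ℕ_; _/ℕ_; a≡a%ℕn+[a/ℕn]*n)
open import Data.Integer.Divisibility.Signed using (divides; ∣ᵤ⇒∣; ∣⇒∣ᵤ)
open import Data.Integer.Tactic.RingSolver using (solve-∀)
open import Data.Nat as ℕ using (ℕ; NonZero; zero; suc; _<_; _≤_; z≤n; s≤s; ≢-nonZero)
import Data.Nat.Properties as ℕ
open import Data.Nat.DivMod using (_mod_; _%_; m<n⇒m%n≡m; [m+kn]%n≡m%n)
open import Data.Nat.Divisibility using () renaming (_∣_ to _∣ℕ_)
open import Data.Nat.Primality using (Prime; euclidsLemma)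
open import Data.Nat.Coprimality as Coprimality using (coprime-Bézout; prime⇒coprime)
open import Data.Nat.GCD using (module Bézout)
open import Data.Product using (∃-syntax; ∃₂; _×_; _,_)
open import Data.Sum as Sum using (_⊎_; inj₁; inj₂)
open import Function using (_∘_; case_of_)
open import Function.Bundles using (_⇔_; Equivalence; Injection; mk↣)
open import Function.Construct.Composition using (_↣-∘_)
open import Function.Definitions using (Injective)
open import Function.Properties.Inverse using (↔⇒↣)
open import Relation.Binary.Bundles using (Setoid)
import Relation.Binary.Reasoning.Setoid as ≈-Reasoning
open import Relation.Binary.PropositionalEquality
open import Relation.Nullary using (¬_; yes; no; contradiction)
open import Relation.Nullary.Decidable using (_×-dec_; ¬?)
open import Relation.Unary using (Decidable)

private
  variable
    m n k : ℕ

enum : (X : Subset n) → Fin ∣ X ∣ → Fin n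
enum (true ∷ X) zero = zero
enum (true ∷ X) (suc i) = suc (enum X i)
enum (false ∷ X) i = suc (enum X i)

enum-∈ : (X : Subset n) (i : Fin ∣ X ∣) → enum X i ∈ X
enum-∈ (true ∷ X) zero = here
enum-∈ (true ∷ X) (suc i) = there (enum-∈ X i)
enum-∈ (false ∷ X) i = there (enum-∈ X i)

enum-injective : (X : Subset n) → Injective _≡_ _≡_ (enum X)
enum-injective (true ∷ X) {zero} {zero} _ = refl
enum-injective (true ∷ X) {suc i} {suc j} e = cong suc (enum-injective X (suc-injective e))
enum-injective (false ∷ X) e = enum-injective X (suc-injective e)

index : {X : Subset n} {x : Fin n} → x ∈ X → Fin ∣ X ∣
index {X = true ∷ X} here = zero
index {X = true ∷ X} (there x∈X) = suc (index x∈X)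
index {X = false ∷ X} (there x∈X) = index x∈X

index-injective : {X : Subset n} {x y : Fin n} (x∈X : x ∈ X) (y∈X : y ∈ X) →
                  index x∈X ≡ index y∈X → x ≡ y
index-injective {X = true ∷ X} here here _ = refl
index-injective {X = true ∷ X} (there x∈X) (there y∈X) e =
  cong suc (index-injective x∈X y∈X (suc-injective e))
index-injective {X = false ∷ X} (there x∈X) (there y∈X) e =
  cong suc (index-injective x∈X y∈X e)

Empty⇒∣∣≡0 : {X : Subset n} → Empty X → ∣ X ∣ ≡ 0
Empty⇒∣∣≡0 {n} X-empty = trans (cong ∣_∣ (Empty-unique X-empty)) (∣⊥∣≡0 n)

1<∣∣⇒two-members : {X : Subset n} → 1 < ∣ X ∣ → ∃₂ λ x y → x ∈ X × y ∈ X × x ≢ y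
1<∣∣⇒two-members {X = X} 1<∣X∣ with ∣ X ∣ | 1<∣X∣ | enum X | enum-∈ X | enum-injective X
... | suc (suc _) | _ | f | f∈X | f-injective =
  f zero , f (suc zero) , f∈X zero , f∈X (suc zero) , λ e → case f-injective e of λ ()
... | suc zero | s≤s () | _ | _ | _

injectiveOn⇒∣∣*∣∣≤∣∣ : {X : Subset m} {Y : Subset n} {Z : Subset k} (f : Fin m → Fin n → Fin k) →
  (∀ {x y} → x ∈ X → y ∈ Y → f x y ∈ Z) →
  (∀ {x y x′ y′} → x ∈ X → y ∈ Y → x′ ∈ X → y′ ∈ Y → f x y ≡ f x′ y′ → x ≡ x′ × y ≡ y′) →
  ∣ X ∣ ℕ.* ∣ Y ∣ ≤ ∣ Z ∣
injectiveOn⇒∣∣*∣∣≤∣∣ {X = X} {Y} {Z} f f∈Z f-injective =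
  injective⇒≤ (Injection.injective (mk↣ pick-injective ↣-∘ ↔⇒↣ *↔×))
  where
  pick : Fin ∣ X ∣ × Fin ∣ Y ∣ → Fin ∣ Z ∣
  pick (i , j) = index (f∈Z (enum-∈ X i) (enum-∈ Y j))
  pick-injective : Injective _≡_ _≡_ pick
  pick-injective {i , j} {i′ , j′} e =
    let x≡x′ , y≡y′ = f-injective (enum-∈ X i) (enum-∈ Y j) (enum-∈ X i′) (enum-∈ Y j′)
                                  (index-injective (f∈Z _ _) (f∈Z _ _) e)
    in cong₂ _,_ (enum-injective X x≡x′) (enum-injective Y y≡y′)

exit-point : {P : ℕ → Set} → Decidable P → P 0 → ¬ P n → ∃[ j ] P j × ¬ P (suc j)
exit-point {zero} _ P0 ¬P0 = contradiction P0 ¬P0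
exit-point {suc n} P? P0 ¬P[1+n] with P? n
... | yes Pn = n , Pn , ¬P[1+n]
... | no ¬Pn = exit-point P? P0 ¬Pn

module Congruence (m : ℕ) where
  open import Data.Integer using (+_; 0ℤ; 1ℤ; _+_; _-_; -_; _*_)

  infix 4 _≈_
  record _≈_ (i j : ℤ) : Set where
    constructor mk≈
    field
      quotient : ℤ
      equation : i ≡ j + quotient * + m

  private
    variable
      i i′ j j′ l : ℤ

  ≡⇒≈ : i ≡ j → i ≈ j
  ≡⇒≈ {i} refl = mk≈ 0ℤ (lemma i (+ m))
    where
    lemma : ∀ i m → i ≡ i + 0ℤ * m
    lemma = solve-∀

  ≈-refl : i ≈ i
  ≈-refl = ≡⇒≈ refl

  ≈-sym : i ≈ j → j ≈ i
  ≈-sym {j = j} (mk≈ q e) = mk≈ (- q) (trans (lemma j q (+ m)) (cong (_+ (- q) * + m) (sym e)))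
    where
    lemma : ∀ j q m → j ≡ (j + q * m) + (- q) * m
    lemma = solve-∀

  ≈-trans : i ≈ j → j ≈ l → i ≈ l
  ≈-trans {l = l} (mk≈ q refl) (mk≈ q′ refl) = mk≈ (q′ + q) (lemma l q q′ (+ m))
    where
    lemma : ∀ l q q′ m → (l + q′ * m) + q * m ≡ l + (q′ + q) * m
    lemma = solve-∀

  ≈-setoid : Setoid _ _
  ≈-setoid = record
    { Carrier = ℤ
    ; _≈_ = _≈_
    ; isEquivalence = record { refl = ≈-refl ; sym = ≈-sym ; trans = ≈-trans }
    }

  +-cong : i ≈ j → i′ ≈ j′ → i + i′ ≈ j + j′
  +-cong {j = j} {j′ = j′} (mk≈ q refl) (mk≈ q′ refl) = mk≈ (q + q′) (lemma j j′ q q′ (+ m))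
    where
    lemma : ∀ j j′ q q′ m → (j + q * m) + (j′ + q′ * m) ≡ (j + j′) + (q + q′) * m
    lemma = solve-∀

  *-cong : i ≈ j → i′ ≈ j′ → i * i′ ≈ j * j′
  *-cong {j = j} {j′ = j′} (mk≈ q refl) (mk≈ q′ refl) =
    mk≈ (q * j′ + j * q′ + q * q′ * + m) (lemma j j′ q q′ (+ m))
    where
    lemma : ∀ j j′ q q′ m → (j + q * m) * (j′ + q′ * m) ≡ j * j′ + (q * j′ + j * q′ + q * q′ * m) * m
    lemma = solve-∀

  -‿cong : i ≈ j → - i ≈ - j
  -‿cong {j = j} (mk≈ q refl) = mk≈ (- q) (lemma j q (+ m))
    where
    lemma : ∀ j q m → - (j + q * m) ≡ - j + (- q) * m
    lemma = solve-∀

  multiple≈0 : ∀ q → q * + m ≈ 0ℤ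
  multiple≈0 q = mk≈ q (sym (ℤ.+-identityˡ _))

  m≈0 : + m ≈ 0ℤ
  m≈0 = subst (_≈ 0ℤ) (ℤ.*-identityˡ (+ m)) (multiple≈0 1ℤ)

  -≈0⇒≈ : i - j ≈ 0ℤ → i ≈ j
  -≈0⇒≈ {i} {j} i-j≈0 = begin
    i             ≡⟨ lemma i j ⟩
    (i - j) + j   ≈⟨ +-cong i-j≈0 ≈-refl ⟩
    0ℤ + j        ≡⟨ ℤ.+-identityˡ j ⟩
    j             ∎
    where
    open ≈-Reasoning ≈-setoid
    lemma : ∀ i j → i ≡ (i - j) + j
    lemma = solve-∀

  ≈0⇒∣ : i ≈ 0ℤ → m ∣ℕ ℤ.∣ i ∣
  ≈0⇒∣ (mk≈ q e) = ∣⇒∣ᵤ (divides q (trans e (ℤ.+-identityˡ _)))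

  ∣⇒≈0 : m ∣ℕ ℤ.∣ i ∣ → i ≈ 0ℤ
  ∣⇒≈0 m∣i with ∣ᵤ⇒∣ m∣i
  ... | divides q e = mk≈ q (trans e (sym (ℤ.+-identityˡ _)))

  *≈0⇒≈0 : Prime m → i * j ≈ 0ℤ → i ≈ 0ℤ ⊎ j ≈ 0ℤ
  *≈0⇒≈0 {i} {j} m-prime ij≈0 =
    Sum.map ∣⇒≈0 ∣⇒≈0 (euclidsLemma ℤ.∣ i ∣ ℤ.∣ j ∣ m-prime (subst (m ∣ℕ_) (ℤ.abs-* i j) (≈0⇒∣ ij≈0)))

  %ℕ-≈ : .{{_ : NonZero m}} → ∀ i → + (i %ℕ m) ≈ i
  %ℕ-≈ i = ≈-sym (mk≈ (i /ℕ m) (a≡a%ℕn+[a/ℕn]*n i m))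

module Residues (p : ℕ) .{{_ : NonZero p}} where
  open import Data.Integer using (+_; -[1+_]; 0ℤ; 1ℤ; _+_; _-_; -_; _*_)
  open Zp p
  open Congruence p

  private
    variable
      i j : ℤ
      x y u v : Fin p

  ⟦_⟧ : Fin p → ℤ
  ⟦ x ⟧ = + toℕ x

  infix 4 _∼_
  _∼_ : Fin p → ℤ → Set
  x ∼ i = ⟦ x ⟧ ≈ i

  ∼⟦⟧ : ∀ x → x ∼ ⟦ x ⟧
  ∼⟦⟧ x = ≈-refl

  mod-∼ : ∀ n → n mod p ∼ + n
  mod-∼ n = ≈-trans (≡⇒≈ (cong +_ (toℕ-fromℕ< _))) (%ℕ-≈ (+ n))

  infixl 6 _⟨+⟩_ _⟨-⟩_
  infixl 7 _⟨*⟩_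

  _⟨+⟩_ : x ∼ i → y ∼ j → x +ₚ y ∼ i + j
  _⟨+⟩_ {x} {y = y} x∼i y∼j =
    ≈-trans (mod-∼ _) (≈-trans (≡⇒≈ (ℤ.pos-+ (toℕ x) (toℕ y))) (+-cong x∼i y∼j))

  _⟨*⟩_ : x ∼ i → y ∼ j → x *ₚ y ∼ i * j
  _⟨*⟩_ {x} {y = y} x∼i y∼j =
    ≈-trans (mod-∼ _) (≈-trans (≡⇒≈ (ℤ.pos-* (toℕ x) (toℕ y))) (*-cong x∼i y∼j))

  -ₚ-∼ : x ∼ i → -ₚ x ∼ - i
  -ₚ-∼ {x} {i} x∼i = begin
    ⟦ -ₚ x ⟧                ≈⟨ mod-∼ (p ℕ.∸ toℕ x) ⟩
    + (p ℕ.∸ toℕ x)         ≡⟨ sym (ℤ.⊖-≥ (ℕ.<⇒≤ (toℕ<n x))) ⟩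
    p ℤ.⊖ toℕ x             ≡⟨ sym (ℤ.[+m]-[+n]≡m⊖n p (toℕ x)) ⟩
    + p - ⟦ x ⟧             ≈⟨ +-cong m≈0 (-‿cong x∼i) ⟩
    0ℤ - i                  ≡⟨ ℤ.+-identityˡ (- i) ⟩
    - i                     ∎
    where open ≈-Reasoning ≈-setoid

  _⟨-⟩_ : x ∼ i → y ∼ j → x -ₚ y ∼ i - j
  x∼i ⟨-⟩ y∼j = x∼i ⟨+⟩ -ₚ-∼ y∼j

  private
    ≡+multiple⇒≡ : ∀ q → ⟦ x ⟧ ≡ ⟦ y ⟧ + + q * + p → x ≡ y
    ≡+multiple⇒≡ {x} {y} q e = toℕ-injective (begin
      toℕ x                   ≡⟨ m<n⇒m%n≡m (toℕ<n x) ⟨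
      toℕ x % p               ≡⟨ cong (_% p) (ℤ.+-injective (trans e (sym (pos-+-* (toℕ y) q p)))) ⟩
      (toℕ y ℕ.+ q ℕ.* p) % p  ≡⟨ [m+kn]%n≡m%n (toℕ y) q p ⟩
      toℕ y % p               ≡⟨ m<n⇒m%n≡m (toℕ<n y) ⟩
      toℕ y                   ∎)
      where
      open ≡-Reasoning
      pos-+-* : ∀ a b c → + (a ℕ.+ b ℕ.* c) ≡ + a + + b * + c
      pos-+-* a b c = trans (ℤ.pos-+ a (b ℕ.* c)) (cong (_+_ (+ a)) (ℤ.pos-* b c))

  ⟦⟧-injective : ⟦ x ⟧ ≈ ⟦ y ⟧ → x ≡ y
  ⟦⟧-injective (mk≈ (+ q) e) = ≡+multiple⇒≡ q e
  -- ≈-sym turns the quotient -[1+ q ] into + suc q.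
  ⟦⟧-injective x≈y@(mk≈ -[1+ q ] _) = sym (≡+multiple⇒≡ (suc q) (_≈_.equation (≈-sym x≈y)))

  ∼-≡⇒≈ : x ∼ i → y ∼ j → x ≡ y → i ≈ j
  ∼-≡⇒≈ x∼i y∼j refl = ≈-trans (≈-sym x∼i) y∼j

  ∼-≈⇒≡ : x ∼ i → y ∼ j → i ≈ j → x ≡ y
  ∼-≈⇒≡ x∼i y∼j i≈j = ⟦⟧-injective (≈-trans x∼i (≈-trans i≈j (≈-sym y∼j)))

  0ₚ : Fin p
  0ₚ = 0 mod p

  -ₚ≡0ₚ⇒≡ : x -ₚ y ≡ 0ₚ → x ≡ y
  -ₚ≡0ₚ⇒≡ {x} {y} e = ⟦⟧-injective (-≈0⇒≈ (∼-≡⇒≈ (∼⟦⟧ x ⟨-⟩ ∼⟦⟧ y) (mod-∼ 0) e))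

  *ₚ-cancelˡ : Prime p → ∀ {d} → d ≢ 0ₚ → d *ₚ u ≡ d *ₚ v → u ≡ v
  *ₚ-cancelˡ {u} {v} p-prime {d} d≢0 du≡dv with *≈0⇒≈0 p-prime d[u-v]≈0
    where
    d[u-v]≈0 : ⟦ d ⟧ * (⟦ u ⟧ - ⟦ v ⟧) ≈ 0ℤ
    d[u-v]≈0 = begin
      ⟦ d ⟧ * (⟦ u ⟧ - ⟦ v ⟧)               ≡⟨ lemma ⟦ d ⟧ ⟦ u ⟧ ⟦ v ⟧ ⟩
      ⟦ d ⟧ * ⟦ u ⟧ - ⟦ d ⟧ * ⟦ v ⟧         ≈⟨ +-cong (∼-≡⇒≈ (∼⟦⟧ d ⟨*⟩ ∼⟦⟧ u) (∼⟦⟧ d ⟨*⟩ ∼⟦⟧ v) du≡dv) ≈-refl ⟩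
      ⟦ d ⟧ * ⟦ v ⟧ - ⟦ d ⟧ * ⟦ v ⟧         ≡⟨ ℤ.+-inverseʳ (⟦ d ⟧ * ⟦ v ⟧) ⟩
      0ℤ                                    ∎
      where
      open ≈-Reasoning ≈-setoid
      lemma : ∀ d u v → d * (u - v) ≡ d * u - d * v
      lemma = solve-∀
  ... | inj₁ d≈0 = contradiction (∼-≈⇒≡ (∼⟦⟧ d) (mod-∼ 0) d≈0) d≢0
  ... | inj₂ u-v≈0 = ⟦⟧-injective (-≈0⇒≈ u-v≈0)

  multiple : Fin p → ℕ → Fin p
  multiple a k = (k ℕ.* toℕ a) mod p

  multiple-∼ : ∀ a k → multiple a k ∼ + k * ⟦ a ⟧
  multiple-∼ a k = ≈-trans (mod-∼ _) (≡⇒≈ (ℤ.pos-* k (toℕ a)))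

  multiple-suc : ∀ a k → multiple a (suc k) ≡ multiple a k +ₚ a
  multiple-suc a k = ∼-≈⇒≡ (multiple-∼ a (suc k)) (multiple-∼ a k ⟨+⟩ ∼⟦⟧ a)
    (≡⇒≈ (trans (cong (_* ⟦ a ⟧) (ℤ.pos-+ 1 k)) (lemma (+ k) ⟦ a ⟧)))
    where
    lemma : ∀ k a → (1ℤ + k) * a ≡ k * a + a
    lemma = solve-∀

  invertible : Prime p → ∀ {a} → toℕ a ≢ 0 → ∃[ b ] b * ⟦ a ⟧ ≈ 1ℤ
  invertible p-prime {a} a≢0
    with coprime-Bézout (Coprimality.sym (prime⇒coprime p-prime {{≢-nonZero a≢0}} (toℕ<n a)))
  ... | Bézout.+- s t eq = + s , (begin
    + s * ⟦ a ⟧           ≡⟨ ℤ.pos-* s (toℕ a) ⟨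
    + (s ℕ.* toℕ a)       ≡⟨ cong +_ eq ⟨
    + (1 ℕ.+ t ℕ.* p)     ≡⟨ cong (_+_ 1ℤ) (ℤ.pos-* t p) ⟩
    1ℤ + + t * + p        ≈⟨ +-cong (≈-refl {1ℤ}) (multiple≈0 (+ t)) ⟩
    1ℤ + 0ℤ               ≡⟨⟩
    1ℤ                    ∎)
    where open ≈-Reasoning ≈-setoid
  ... | Bézout.-+ s t eq = - + s , (begin
    - + s * ⟦ a ⟧                ≡⟨ lemma (+ s) ⟦ a ⟧ ⟩
    1ℤ - (1ℤ + + s * ⟦ a ⟧)      ≡⟨ cong (λ w → 1ℤ - (1ℤ + w)) (ℤ.pos-* s (toℕ a)) ⟨
    1ℤ - + (1 ℕ.+ s ℕ.* toℕ a)  ≡⟨ cong (λ w → 1ℤ - w) (trans (cong +_ eq) (ℤ.pos-* t p)) ⟩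
    1ℤ - + t * + p              ≈⟨ +-cong (≈-refl {1ℤ}) (-‿cong (multiple≈0 (+ t))) ⟩
    1ℤ - 0ℤ                     ≡⟨⟩
    1ℤ                          ∎)
    where
    open ≈-Reasoning ≈-setoid
    lemma : ∀ s a → - s * a ≡ 1ℤ - (1ℤ + s * a)
    lemma = solve-∀

  multiple-surjective : Prime p → ∀ {a} → toℕ a ≢ 0 → ∀ z → ∃[ k ] multiple a k ≡ z
  multiple-surjective p-prime {a} a≢0 z with invertible p-prime a≢0
  ... | b , ba≈1 = (⟦ z ⟧ * b) %ℕ p , ∼-≈⇒≡ (multiple-∼ a ((⟦ z ⟧ * b) %ℕ p)) (∼⟦⟧ z) (begin
    + ((⟦ z ⟧ * b) %ℕ p) * ⟦ a ⟧  ≈⟨ *-cong (%ℕ-≈ (⟦ z ⟧ * b)) ≈-refl ⟩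
    ⟦ z ⟧ * b * ⟦ a ⟧             ≡⟨ ℤ.*-assoc ⟦ z ⟧ b ⟦ a ⟧ ⟩
    ⟦ z ⟧ * (b * ⟦ a ⟧)           ≈⟨ *-cong (≈-refl {⟦ z ⟧}) ba≈1 ⟩
    ⟦ z ⟧ * 1ℤ                    ≡⟨ ℤ.*-identityʳ ⟦ z ⟧ ⟩
    ⟦ z ⟧                         ∎)
    where open ≈-Reasoning ≈-setoid

  escape-by-translation : Prime p → ∀ {a} → toℕ a ≢ 0 → {P : Fin p → Set} → Decidable P →
                          P 0ₚ → ∀ z → ¬ P z → ∃[ ξ ] P ξ × ¬ P (ξ +ₚ a)
  escape-by-translation p-prime {a} a≢0 {P} P? P0 z ¬Pz =
    -- P0 is accepted as P (multiple a 0), which reduces to P 0ₚ.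
    let k , ak≡z = multiple-surjective p-prime a≢0 z
        j , Paj , ¬Pa[1+j] = exit-point {n = k} (P? ∘ multiple a) P0 (¬Pz ∘ subst P ak≡z)
    in multiple a j , Paj , ¬Pa[1+j] ∘ subst P (sym (multiple-suc a j))

module DifferenceQuotients (p : ℕ) .{{_ : NonZero p}} (X Y : Subset p) where
  open import Data.Integer using (0ℤ; _+_; _-_; _*_)
  open Zp p
  open Congruence p
  open Residues p

  private
    variable
      x x′ y y′ : Fin p

  InQ? : Decidable (InQ X Y)
  InQ? z = any? λ x₁ → any? λ x₂ → any? λ y₁ → any? λ y₂ →
    x₁ ∈? X ×-dec x₂ ∈? X ×-dec y₁ ∈? Y ×-dec y₂ ∈? Y ×-dec ¬? (y₁ ≟ y₂) ×-dec
    (z *ₚ (y₁ -ₚ y₂) ≟ x₁ -ₚ x₂)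

  0∈Q : x ∈ X → y ∈ Y → y′ ∈ Y → y ≢ y′ → InQ X Y 0ₚ
  0∈Q {x} {y} {y′} x∈X y∈Y y′∈Y y≢y′ = x , x , y , y′ , x∈X , x∈X , y∈Y , y′∈Y , y≢y′ ,
    ∼-≈⇒≡ (mod-∼ 0 ⟨*⟩ (∼⟦⟧ y ⟨-⟩ ∼⟦⟧ y′)) (∼⟦⟧ x ⟨-⟩ ∼⟦⟧ x) (≡⇒≈ (lemma ⟦ y ⟧ ⟦ y′ ⟧ ⟦ x ⟧))
    where
    lemma : ∀ y y′ x → 0ℤ * (y - y′) ≡ x - x
    lemma = solve-∀

  slope : ∀ x y x′ y′ c → x +ₚ c *ₚ y ≡ x′ +ₚ c *ₚ y′ → c *ₚ (y -ₚ y′) ≡ x′ -ₚ x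
  slope x y x′ y′ c e = ∼-≈⇒≡ (∼⟦⟧ c ⟨*⟩ (∼⟦⟧ y ⟨-⟩ ∼⟦⟧ y′)) (∼⟦⟧ x′ ⟨-⟩ ∼⟦⟧ x) (begin
    ⟦ c ⟧ * (⟦ y ⟧ - ⟦ y′ ⟧)                          ≡⟨ lemma₁ ⟦ x ⟧ ⟦ y ⟧ ⟦ y′ ⟧ ⟦ c ⟧ ⟩
    (⟦ x ⟧ + ⟦ c ⟧ * ⟦ y ⟧) - (⟦ x ⟧ + ⟦ c ⟧ * ⟦ y′ ⟧)   ≈⟨ +-cong x+cy≈x′+cy′ ≈-refl ⟩
    (⟦ x′ ⟧ + ⟦ c ⟧ * ⟦ y′ ⟧) - (⟦ x ⟧ + ⟦ c ⟧ * ⟦ y′ ⟧) ≡⟨ lemma₂ ⟦ x ⟧ ⟦ x′ ⟧ (⟦ c ⟧ * ⟦ y′ ⟧) ⟩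
    ⟦ x′ ⟧ - ⟦ x ⟧                                    ∎)
    where
    open ≈-Reasoning ≈-setoid
    x+cy≈x′+cy′ : ⟦ x ⟧ + ⟦ c ⟧ * ⟦ y ⟧ ≈ ⟦ x′ ⟧ + ⟦ c ⟧ * ⟦ y′ ⟧
    x+cy≈x′+cy′ = ∼-≡⇒≈ (∼⟦⟧ x ⟨+⟩ ∼⟦⟧ c ⟨*⟩ ∼⟦⟧ y) (∼⟦⟧ x′ ⟨+⟩ ∼⟦⟧ c ⟨*⟩ ∼⟦⟧ y′) e
    lemma₁ : ∀ x y y′ c → c * (y - y′) ≡ (x + c * y) - (x + c * y′)
    lemma₁ = solve-∀
    lemma₂ : ∀ x x′ w → (x′ + w) - (x + w) ≡ x′ - x
    lemma₂ = solve-∀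

  +ₚ*ₚ-injectiveOn : ∀ c → ¬ InQ X Y c → x ∈ X → y ∈ Y → x′ ∈ X → y′ ∈ Y →
                     x +ₚ c *ₚ y ≡ x′ +ₚ c *ₚ y′ → x ≡ x′ × y ≡ y′
  +ₚ*ₚ-injectiveOn {x} {y} {x′} {y′} c c∉Q x∈X y∈Y x′∈X y′∈Y e with y ≟ y′
  ... | yes refl = sym (-ₚ≡0ₚ⇒≡ (trans (sym (slope x y x′ y c e)) c[y-y]≡0)) , refl
    where
    c[y-y]≡0 : c *ₚ (y -ₚ y) ≡ 0ₚ
    c[y-y]≡0 = ∼-≈⇒≡ (∼⟦⟧ c ⟨*⟩ (∼⟦⟧ y ⟨-⟩ ∼⟦⟧ y)) (mod-∼ 0) (≡⇒≈ (lemma ⟦ c ⟧ ⟦ y ⟧))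
      where
      lemma : ∀ c y → c * (y - y) ≡ 0ℤ
      lemma = solve-∀
  ... | no y≢y′ =
    contradiction (x′ , x , y , y′ , x′∈X , x∈X , y∈Y , y′∈Y , y≢y′ , slope x y x′ y′ c e) c∉Q

  module Embedding (a x₁ x₂ y₁ y₂ : Fin p) where

    embed : Fin p → Fin p → Fin p
    embed x y = x *ₚ y₁ +ₚ x₁ *ₚ y -ₚ (x *ₚ y₂ +ₚ x₂ *ₚ y) +ₚ a *ₚ (y₁ *ₚ y) -ₚ a *ₚ (y₂ *ₚ y)

    embed-∈ : x₁ ∈ X → x₂ ∈ X → y₁ ∈ Y → y₂ ∈ Y → x ∈ X → y ∈ Y → InS a X Y (embed x y)
    embed-∈ {x} {y} x₁∈X x₂∈X y₁∈Y y₂∈Y x∈X y∈Y = _ , _ , _ , _ ,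
      (_ , _ , (x , y₁ , x∈X , y₁∈Y , refl) , (x₁ , y , x₁∈X , y∈Y , refl) , refl) ,
      (_ , _ , (x , y₂ , x∈X , y₂∈Y , refl) , (x₂ , y , x₂∈X , y∈Y , refl) , refl) ,
      (_ , (y₁ , y , y₁∈Y , y∈Y , refl) , refl) ,
      (_ , (y₂ , y , y₂∈Y , y∈Y , refl) , refl) ,
      refl

    embed-factor : ∀ ξ → ξ *ₚ (y₁ -ₚ y₂) ≡ x₁ -ₚ x₂ →
                   ∀ x y → embed x y ≡ (y₁ -ₚ y₂) *ₚ (x +ₚ (ξ +ₚ a) *ₚ y)
    embed-factor ξ ξ-eq x y = ∼-≈⇒≡
      (∼⟦⟧ x ⟨*⟩ ∼⟦⟧ y₁ ⟨+⟩ ∼⟦⟧ x₁ ⟨*⟩ ∼⟦⟧ y ⟨-⟩ (∼⟦⟧ x ⟨*⟩ ∼⟦⟧ y₂ ⟨+⟩ ∼⟦⟧ x₂ ⟨*⟩ ∼⟦⟧ y)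
        ⟨+⟩ ∼⟦⟧ a ⟨*⟩ (∼⟦⟧ y₁ ⟨*⟩ ∼⟦⟧ y) ⟨-⟩ ∼⟦⟧ a ⟨*⟩ (∼⟦⟧ y₂ ⟨*⟩ ∼⟦⟧ y))
      ((∼⟦⟧ y₁ ⟨-⟩ ∼⟦⟧ y₂) ⟨*⟩ (∼⟦⟧ x ⟨+⟩ (∼⟦⟧ ξ ⟨+⟩ ∼⟦⟧ a) ⟨*⟩ ∼⟦⟧ y))
      (begin
        ⟦ x ⟧ * ⟦ y₁ ⟧ + ⟦ x₁ ⟧ * ⟦ y ⟧ - (⟦ x ⟧ * ⟦ y₂ ⟧ + ⟦ x₂ ⟧ * ⟦ y ⟧)
          + ⟦ a ⟧ * (⟦ y₁ ⟧ * ⟦ y ⟧) - ⟦ a ⟧ * (⟦ y₂ ⟧ * ⟦ y ⟧)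
          ≡⟨ lemma₁ ⟦ x ⟧ ⟦ y ⟧ ⟦ x₁ ⟧ ⟦ x₂ ⟧ ⟦ y₁ ⟧ ⟦ y₂ ⟧ ⟦ a ⟧ ⟩
        (⟦ y₁ ⟧ - ⟦ y₂ ⟧) * ⟦ x ⟧ + (⟦ x₁ ⟧ - ⟦ x₂ ⟧) * ⟦ y ⟧ + ⟦ a ⟧ * (⟦ y₁ ⟧ - ⟦ y₂ ⟧) * ⟦ y ⟧
          ≈⟨ +-cong (+-cong (≈-refl {(⟦ y₁ ⟧ - ⟦ y₂ ⟧) * ⟦ x ⟧}) (*-cong (≈-sym ξ[y₁-y₂]≈x₁-x₂) (≈-refl {⟦ y ⟧})))
                    (≈-refl {⟦ a ⟧ * (⟦ y₁ ⟧ - ⟦ y₂ ⟧) * ⟦ y ⟧}) ⟩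
        (⟦ y₁ ⟧ - ⟦ y₂ ⟧) * ⟦ x ⟧ + ⟦ ξ ⟧ * (⟦ y₁ ⟧ - ⟦ y₂ ⟧) * ⟦ y ⟧ + ⟦ a ⟧ * (⟦ y₁ ⟧ - ⟦ y₂ ⟧) * ⟦ y ⟧
          ≡⟨ lemma₂ ⟦ x ⟧ ⟦ y ⟧ ⟦ y₁ ⟧ ⟦ y₂ ⟧ ⟦ ξ ⟧ ⟦ a ⟧ ⟩
        (⟦ y₁ ⟧ - ⟦ y₂ ⟧) * (⟦ x ⟧ + (⟦ ξ ⟧ + ⟦ a ⟧) * ⟦ y ⟧)
          ∎)
      where
      open ≈-Reasoning ≈-setoid
      ξ[y₁-y₂]≈x₁-x₂ : ⟦ ξ ⟧ * (⟦ y₁ ⟧ - ⟦ y₂ ⟧) ≈ ⟦ x₁ ⟧ - ⟦ x₂ ⟧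
      ξ[y₁-y₂]≈x₁-x₂ = ∼-≡⇒≈ (∼⟦⟧ ξ ⟨*⟩ (∼⟦⟧ y₁ ⟨-⟩ ∼⟦⟧ y₂)) (∼⟦⟧ x₁ ⟨-⟩ ∼⟦⟧ x₂) ξ-eq
      lemma₁ : ∀ x y x₁ x₂ y₁ y₂ a →
        x * y₁ + x₁ * y - (x * y₂ + x₂ * y) + a * (y₁ * y) - a * (y₂ * y) ≡
        (y₁ - y₂) * x + (x₁ - x₂) * y + a * (y₁ - y₂) * y
      lemma₁ = solve-∀
      lemma₂ : ∀ x y y₁ y₂ ξ a →
        (y₁ - y₂) * x + ξ * (y₁ - y₂) * y + a * (y₁ - y₂) * y ≡ (y₁ - y₂) * (x + (ξ + a) * y)
      lemma₂ = solve-∀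

    embed-injectiveOn : Prime p → y₁ ≢ y₂ → ∀ ξ → ξ *ₚ (y₁ -ₚ y₂) ≡ x₁ -ₚ x₂ → ¬ InQ X Y (ξ +ₚ a) →
                        x ∈ X → y ∈ Y → x′ ∈ X → y′ ∈ Y → embed x y ≡ embed x′ y′ → x ≡ x′ × y ≡ y′
    embed-injectiveOn {x} {y} {x′} {y′} p-prime y₁≢y₂ ξ ξ-eq ξ+a∉Q x∈X y∈Y x′∈X y′∈Y e =
      +ₚ*ₚ-injectiveOn (ξ +ₚ a) ξ+a∉Q x∈X y∈Y x′∈X y′∈Y (*ₚ-cancelˡ p-prime (y₁≢y₂ ∘ -ₚ≡0ₚ⇒≡)
        (trans (sym (embed-factor ξ ξ-eq x y)) (trans e (embed-factor ξ ξ-eq x′ y′))))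

open import Data.Nat using (_*_)

lemma4 : (p : ℕ) .{{_ : NonZero p}} → Prime p → 2 < p →
    (X Y : Subset p) → 1 < ∣ Y ∣ → (a : Fin p) → toℕ a ≢ 0 →
    ¬ (∀ z → Zp.InQ p X Y z) →
    (S : Subset p) → (∀ z → (z ∈ S) ⇔ Zp.InS p a X Y z) →
    ∣ X ∣ * ∣ Y ∣ ≤ ∣ S ∣
lemma4 p p-prime _ X Y 1<∣Y∣ a a≢0 Q≢ℤₚ S S⇔InS with nonempty? X
... | no X-empty = subst (λ n → n * ∣ Y ∣ ≤ ∣ S ∣) (sym (Empty⇒∣∣≡0 X-empty)) z≤n
... | yes (x , x∈X) =
  let open DifferenceQuotients p X Y
      open Residues p
      y₁ , y₂ , y₁∈Y , y₂∈Y , y₁≢y₂ = 1<∣∣⇒two-members 1<∣Y∣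
      z , z∉Q = ¬∀⟶∃¬ p (Zp.InQ p X Y) InQ? Q≢ℤₚ
      ξ , (x₁ , x₂ , w₁ , w₂ , x₁∈X , x₂∈X , w₁∈Y , w₂∈Y , w₁≢w₂ , ξ-eq) , ξ+a∉Q =
        escape-by-translation p-prime a≢0 InQ? (0∈Q x∈X y₁∈Y y₂∈Y y₁≢y₂) z z∉Q
      open Embedding a x₁ x₂ w₁ w₂
  in injectiveOn⇒∣∣*∣∣≤∣∣ embed
       (λ x∈X y∈Y → Equivalence.from (S⇔InS _) (embed-∈ x₁∈X x₂∈X w₁∈Y w₂∈Y x∈X y∈Y))
       (embed-injectiveOn p-prime w₁≢w₂ ξ ξ-eq ξ+a∉Q)
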